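{- Let $k\geq 2$ and $r\geq 2$ be integers. Then \[ \sum_{n_{1}n_{2}\cdots n_{r}=k}\omega\left([n_{1},n_{2},\dots,n_{r}]\right)=\omega(k)\tau_{r}(k), \] and moreover \[ \sum_{m=1}^{r}(-1)^{m-1}\binom{r}{m}\sum_{n_{1}n_{2}\cdots n_{r}=k}\omega\left((n_{1},n_{2},\dots,n_{m})\right)=\omega(k)\tau_{r}(k), \] where the inner sums run over all ordered $r$-tuples of positive integers with product $k$.
   Context: $\omega(n)$ is the number of distinct prime divisors of $n$. $[n_1,\dots,n_r]$ is the lcm and $(n_1,\dots,n_m)$ the gcd. $\tau_r(k)$ is the number of ordered $r$-tuples of positive integers with product $k$, equivalently defined by $\zeta(s)^r=\sum_{n\ge1}\tau_r(n)n^{ -s}$ for $\operatorname{Re}(s)>1$. -}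

module Defs where

open import Data.Nat using (ℕ; zero; suc; _+_; _*_; _≟_)
open import Data.Nat.Divisibility using (_∣?_)
open import Data.Nat.Primality using (prime?)
open import Data.Nat.GCD using (gcd)
open import Data.Nat.LCM using (lcm)
open import Data.List using (List; []; _∷_; map; length; filter; upTo; concatMap; foldr; take)
open import Data.Integer as ℤ using (ℤ)
open import Data.Nat.ListAction using (sum; product)
open import Relation.Nullary.Decidable using (_×-dec_)

-- ω(n): number of distinct primes p dividing n (for n ≥ 1 such p satisfy p ≤ n).
ω : ℕ → ℕ
ω n = length (filter (λ p → prime? p ×-dec (p ∣? n)) (upTo (suc n)))

tuplesUpTo : ℕ → ℕ → List (List ℕ)
tuplesUpTo zero    k = [] ∷ []
tuplesUpTo (suc r) k =
  concatMap (λ a → map (λ t → suc a ∷ t) (tuplesUpTo r k)) (upTo k)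

factorizations : ℕ → ℕ → List (List ℕ)
factorizations r k = filter (λ t → product t ≟ k) (tuplesUpTo r k)

τ : ℕ → ℕ → ℕ
τ r k = length (factorizations r k)

lcmList : List ℕ → ℕ
lcmList = foldr lcm 1

gcdFirst : ℕ → List ℕ → ℕ
gcdFirst m t = gcd-list (take m t)
  where
  gcd-list : List ℕ → ℕ
  gcd-list = foldr gcd 0

sumFrom1 : ℕ → (ℕ → ℤ) → ℤ
sumFrom1 zero    f = ℤ.+ 0
sumFrom1 (suc r) f = sumFrom1 r f ℤ.+ f (suc r)

signPred : ℕ → ℤ
signPred zero          = ℤ.+ 1
signPred (suc zero)    = ℤ.+ 1
signPred (suc (suc m)) = ℤ.- signPred (suc m)

-- Every prime dividing k = n₁⋯n_r divides one of the nᵢ, hence their lcm, which itself divides k;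
-- so ω([n₁,…,n_r]) = ω(k) for every factorization.  For the gcd identity write ω(d) as the number of
-- primes p ≤ k dividing d and fix p.  By symmetry of the factorizations, the number of them with
-- p dividing n₁,…,n_m equals the number with p dividing any prescribed m of the entries, so the
-- alternating binomial sum is the inclusion–exclusion count of factorizations with p dividing
-- some nᵢ.  For p ∣ k that is every factorization, and for p ∤ k none.  Inclusion–exclusion
-- itself is proved by induction on r, splitting off one entry and using Pascal's rule.

module Submission where

open import Defs
open import Data.Integer as ℤ using (ℤ; +_; _+_; _-_; _*_; -_)
import Data.Integer.Properties as ℤₚ
open import Data.Integer.Tactic.RingSolver using (solve-∀)
open import Data.List using (List; []; _∷_; _++_; _∷ʳ_; map; concatMap; filter; length; upTo)
import Data.List.Properties as Listₚ
open import Data.List.Relation.Unary.All as All using (All; []; _∷_)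
import Data.List.Relation.Unary.All.Properties as Allₚ
open import Data.Nat as ℕ using (ℕ; zero; suc; _≤_; _<_; s≤s; _≟_; _≤′_; ≤′-refl; ≤′-step)
import Data.Nat.Properties as ℕₚ
open import Data.Nat.Combinatorics using (_C_; nCk+nC[k+1]≡[n+1]C[k+1]; k>n⇒nCk≡0)
open import Data.Nat.Divisibility using (_∣_; _∣?_; ∣-refl; ∣-trans; ∣⇒≤; _∣0; 0∣⇒≡0; ∣1⇒≡1; m∣m*n; n∣m*n)
open import Data.Nat.GCD using (gcd; gcd[m,n]∣m; gcd[m,n]∣n; gcd-greatest)
open import Data.Nat.LCM using (lcm-least; m∣lcm[m,n]; n∣lcm[m,n])
open import Data.Nat.ListAction using (sum; product)
open import Data.Nat.ListAction.Properties using (product-++)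
open import Data.Nat.Primality using (Prime; prime?; euclidsLemma; ¬prime[1])
open import Data.Product using (_×_; _,_)
open import Data.Sum using (inj₁; inj₂)
open import Function using (_∘_)
open import Relation.Nullary using (Dec; yes; no; ¬_; contradiction)
open import Relation.Nullary.Decidable using (_×-dec_)
open import Relation.Unary using (Decidable)
open import Relation.Binary.PropositionalEquality

∑ : {A : Set} → List A → (A → ℤ) → ℤ
∑ []       f = + 0
∑ (x ∷ xs) f = f x + ∑ xs f

infix 5 ∑
syntax ∑ xs (λ x → e) = ∑[ x ∈ xs ] e

𝟙 : {P : Set} → Dec P → ℤ
𝟙 (yes _) = + 1
𝟙 (no _)  = + 0

module _ {A : Set} where

  ∑-cong : ∀ xs {f g : A → ℤ} → (∀ x → f x ≡ g x) → ∑ xs f ≡ ∑ xs g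
  ∑-cong []       f≗g = refl
  ∑-cong (x ∷ xs) f≗g = cong₂ _+_ (f≗g x) (∑-cong xs f≗g)

  ∑-cong-All : ∀ {xs} {f g : A → ℤ} → All (λ x → f x ≡ g x) xs → ∑ xs f ≡ ∑ xs g
  ∑-cong-All []            = refl
  ∑-cong-All (fx≡gx ∷ eqs) = cong₂ _+_ fx≡gx (∑-cong-All eqs)

  ∑-++ : ∀ xs ys (f : A → ℤ) → ∑ (xs ++ ys) f ≡ ∑ xs f + ∑ ys f
  ∑-++ []       ys f = sym (ℤₚ.+-identityˡ _)
  ∑-++ (x ∷ xs) ys f = trans (cong (_+_ (f x)) (∑-++ xs ys f)) (sym (ℤₚ.+-assoc (f x) _ _))

  ∑-zero : ∀ (xs : List A) → ∑[ x ∈ xs ] + 0 ≡ + 0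
  ∑-zero []       = refl
  ∑-zero (x ∷ xs) = trans (ℤₚ.+-identityˡ _) (∑-zero xs)

  ∑-distrib-+ : ∀ xs (f g : A → ℤ) → ∑[ x ∈ xs ] (f x + g x) ≡ ∑ xs f + ∑ xs g
  ∑-distrib-+ []       f g = refl
  ∑-distrib-+ (x ∷ xs) f g =
    trans (cong (_+_ (f x + g x)) (∑-distrib-+ xs f g)) (interchange (f x) (g x) _ _)
    where
    interchange : ∀ a b c d → a + b + (c + d) ≡ a + c + (b + d)
    interchange = solve-∀

  ∑-distrib-minus : ∀ xs (f g : A → ℤ) → ∑[ x ∈ xs ] (f x - g x) ≡ ∑ xs f - ∑ xs g
  ∑-distrib-minus []       f g = refl
  ∑-distrib-minus (x ∷ xs) f g =
    trans (cong (_+_ (f x - g x)) (∑-distrib-minus xs f g)) (interchange (f x) (g x) (∑ xs f) (∑ xs g))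
    where
    interchange : ∀ a b c d → a - b + (c - d) ≡ a + c - (b + d)
    interchange = solve-∀

  ∑-*ˡ : ∀ c xs (f : A → ℤ) → ∑[ x ∈ xs ] (c * f x) ≡ c * ∑ xs f
  ∑-*ˡ c []       f = sym (ℤₚ.*-zeroʳ c)
  ∑-*ˡ c (x ∷ xs) f = trans (cong (_+_ (c * f x)) (∑-*ˡ c xs f)) (sym (ℤₚ.*-distribˡ-+ c (f x) _))

  ∑-const : ∀ c (xs : List A) → ∑[ x ∈ xs ] c ≡ c * + length xs
  ∑-const c []       = sym (ℤₚ.*-zeroʳ c)
  ∑-const c (x ∷ xs) = begin
    c + (∑[ x ∈ xs ] c)       ≡⟨ cong (_+_ c) (∑-const c xs) ⟩
    c + c * + length xs       ≡⟨ cong (λ z → z + c * + length xs) (ℤₚ.*-identityʳ c) ⟨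
    c * + 1 + c * + length xs ≡⟨ ℤₚ.*-distribˡ-+ c (+ 1) _ ⟨
    c * + suc (length xs)     ∎
    where open ≡-Reasoning

  ∑-filter : ∀ {P : A → Set} (P? : Decidable P) xs (f : A → ℤ) →
             ∑ (filter P? xs) f ≡ ∑[ x ∈ xs ] (𝟙 (P? x) * f x)
  ∑-filter P? []       f = refl
  ∑-filter P? (x ∷ xs) f with P? x
  ... | yes _ = cong₂ _+_ (sym (ℤₚ.*-identityˡ (f x))) (∑-filter P? xs f)
  ... | no  _ = trans (∑-filter P? xs f) (sym (ℤₚ.+-identityˡ _))

  length-filter≡∑𝟙 : ∀ {P : A → Set} (P? : Decidable P) xs →
                     + length (filter P? xs) ≡ ∑[ x ∈ xs ] 𝟙 (P? x)
  length-filter≡∑𝟙 P? []       = refl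
  length-filter≡∑𝟙 P? (x ∷ xs) with P? x
  ... | yes _ = trans (ℤₚ.pos-+ 1 _) (cong (_+_ (+ 1)) (length-filter≡∑𝟙 P? xs))
  ... | no  _ = trans (length-filter≡∑𝟙 P? xs) (sym (ℤₚ.+-identityˡ _))

  sum-map≡∑ : ∀ (h : A → ℕ) xs → + sum (map h xs) ≡ ∑[ x ∈ xs ] + h x
  sum-map≡∑ h []       = refl
  sum-map≡∑ h (x ∷ xs) = trans (ℤₚ.pos-+ (h x) _) (cong (_+_ (+ h x)) (sum-map≡∑ h xs))

module _ {A B : Set} where

  ∑-map : ∀ (g : A → B) xs (f : B → ℤ) → ∑ (map g xs) f ≡ ∑[ x ∈ xs ] f (g x)
  ∑-map g []       f = refl
  ∑-map g (x ∷ xs) f = cong (_+_ (f (g x))) (∑-map g xs f)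

  ∑-concatMap : ∀ (g : A → List B) xs (f : B → ℤ) → ∑ (concatMap g xs) f ≡ ∑[ x ∈ xs ] ∑ (g x) f
  ∑-concatMap g []       f = refl
  ∑-concatMap g (x ∷ xs) f = trans (∑-++ (g x) _ f) (cong (_+_ (∑ (g x) f)) (∑-concatMap g xs f))

  ∑-comm : ∀ xs ys (f : A → B → ℤ) → ∑[ x ∈ xs ] ∑[ y ∈ ys ] f x y ≡ ∑[ y ∈ ys ] ∑[ x ∈ xs ] f x y
  ∑-comm []       ys f = sym (∑-zero ys)
  ∑-comm (x ∷ xs) ys f = trans (cong (_+_ (∑ ys (f x))) (∑-comm xs ys f))
                               (sym (∑-distrib-+ ys (f x) (λ y → ∑[ x ∈ xs ] f x y)))

𝟙-×-dec : ∀ {P Q : Set} (P? : Dec P) (Q? : Dec Q) → 𝟙 (P? ×-dec Q?) ≡ 𝟙 P? * 𝟙 Q?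
𝟙-×-dec (yes _) (yes _) = refl
𝟙-×-dec (yes _) (no _)  = refl
𝟙-×-dec (no _)  (yes _) = refl
𝟙-×-dec (no _)  (no _)  = refl

𝟙-*-cong : ∀ {P : Set} (P? : Dec P) {a b : ℤ} → (P → a ≡ b) → 𝟙 P? * a ≡ 𝟙 P? * b
𝟙-*-cong (yes p) a≡b = cong (+ 1 *_) (a≡b p)
𝟙-*-cong (no _)  {a} {b} _ = trans (ℤₚ.*-zeroˡ a) (sym (ℤₚ.*-zeroˡ b))

sumFrom1-cong : ∀ r {f g : ℕ → ℤ} → (∀ {m} → m < r → f (suc m) ≡ g (suc m)) → sumFrom1 r f ≡ sumFrom1 r g
sumFrom1-cong zero    f≗g = refl
sumFrom1-cong (suc r) f≗g = cong₂ _+_ (sumFrom1-cong r (f≗g ∘ ℕₚ.m<n⇒m<1+n)) (f≗g (ℕₚ.n<1+n r))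

sumFrom1-distrib-+ : ∀ r (f g : ℕ → ℤ) → sumFrom1 r (λ m → f m + g m) ≡ sumFrom1 r f + sumFrom1 r g
sumFrom1-distrib-+ zero    f g = refl
sumFrom1-distrib-+ (suc r) f g =
  trans (cong (_+ (f (suc r) + g (suc r))) (sumFrom1-distrib-+ r f g))
        (interchange (sumFrom1 r f) (sumFrom1 r g) (f (suc r)) (g (suc r)))
  where
  interchange : ∀ a b c d → a + b + (c + d) ≡ a + c + (b + d)
  interchange = solve-∀

sumFrom1-*ˡ : ∀ r c (f : ℕ → ℤ) → sumFrom1 r (λ m → c * f m) ≡ c * sumFrom1 r f
sumFrom1-*ˡ zero    c f = sym (ℤₚ.*-zeroʳ c)
sumFrom1-*ˡ (suc r) c f =
  trans (cong (_+ c * f (suc r)) (sumFrom1-*ˡ r c f)) (sym (ℤₚ.*-distribˡ-+ c _ _))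

sumFrom1-∑ : ∀ {A : Set} r xs (f : ℕ → A → ℤ) →
             sumFrom1 r (λ m → ∑[ x ∈ xs ] f m x) ≡ ∑[ x ∈ xs ] sumFrom1 r (λ m → f m x)
sumFrom1-∑ zero    xs f = sym (∑-zero xs)
sumFrom1-∑ (suc r) xs f = trans (cong (_+ ∑ xs (f (suc r))) (sumFrom1-∑ r xs f))
                                (sym (∑-distrib-+ xs (λ x → sumFrom1 r (λ m → f m x)) (f (suc r))))

sumFrom1-suc : ∀ r (f : ℕ → ℤ) → sumFrom1 (suc r) f ≡ f 1 + sumFrom1 r (f ∘ suc)
sumFrom1-suc zero    f = ℤₚ.+-comm (+ 0) (f 1)
sumFrom1-suc (suc r) f = trans (cong (_+ f (suc (suc r))) (sumFrom1-suc r f)) (ℤₚ.+-assoc (f 1) _ _)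

-- Pascal's rule (r+1) C m = r C m + r C (m-1), summed against g.
sumFrom1-binomial : ∀ r (g : ℕ → ℤ) →
  sumFrom1 (suc r) (λ m → + (suc r C m) * g m)
    ≡ sumFrom1 r (λ m → + (r C m) * g m) + (g 1 + sumFrom1 r (λ m → + (r C m) * g (suc m)))
sumFrom1-binomial r g = begin
  sumFrom1 (suc r) (λ m → + (suc r C m) * g m)
    ≡⟨ sumFrom1-cong (suc r) (λ {m} _ → pascal m) ⟩
  sumFrom1 (suc r) (λ m → + (r C m) * g m + + (r C ℕ.pred m) * g m)
    ≡⟨ sumFrom1-distrib-+ (suc r) _ _ ⟩
  sumFrom1 (suc r) (λ m → + (r C m) * g m) + sumFrom1 (suc r) (λ m → + (r C ℕ.pred m) * g m)
    ≡⟨ cong₂ _+_ drop-top (sumFrom1-suc r _) ⟩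
  lower + (+ 1 * g 1 + shifted)
    ≡⟨ cong (λ z → lower + (z + shifted)) (ℤₚ.*-identityˡ (g 1)) ⟩
  lower + (g 1 + shifted)
    ∎
  where
  open ≡-Reasoning
  lower shifted : ℤ
  lower   = sumFrom1 r (λ m → + (r C m) * g m)
  shifted = sumFrom1 r (λ m → + (r C m) * g (suc m))
  pascal : ∀ m → + (suc r C suc m) * g (suc m) ≡ + (r C suc m) * g (suc m) + + (r C m) * g (suc m)
  pascal m = begin
    + (suc r C suc m) * g (suc m)
      ≡⟨ cong (λ c → + c * g (suc m)) (nCk+nC[k+1]≡[n+1]C[k+1] r m) ⟨
    + (r C m ℕ.+ r C suc m) * g (suc m)
      ≡⟨ cong (_* g (suc m)) (ℤₚ.pos-+ (r C m) (r C suc m)) ⟩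
    (+ (r C m) + + (r C suc m)) * g (suc m)
      ≡⟨ ℤₚ.*-distribʳ-+ (g (suc m)) (+ (r C m)) (+ (r C suc m)) ⟩
    + (r C m) * g (suc m) + + (r C suc m) * g (suc m)
      ≡⟨ ℤₚ.+-comm (+ (r C m) * g (suc m)) _ ⟩
    + (r C suc m) * g (suc m) + + (r C m) * g (suc m) ∎
  drop-top : sumFrom1 (suc r) (λ m → + (r C m) * g m) ≡ lower
  drop-top = begin
    lower + + (r C suc r) * g (suc r) ≡⟨ cong (λ c → lower + + c * g (suc r)) (k>n⇒nCk≡0 (ℕₚ.n<1+n r)) ⟩
    lower + + 0 * g (suc r)           ≡⟨ cong (_+_ lower) (ℤₚ.*-zeroˡ (g (suc r))) ⟩
    lower + + 0                       ≡⟨ ℤₚ.+-identityʳ lower ⟩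
    lower                             ∎

prefixProduct : (ℕ → ℤ) → ℕ → List ℕ → ℤ
prefixProduct x zero    _       = + 1
prefixProduct x (suc m) []      = + 1
prefixProduct x (suc m) (a ∷ t) = x a * prefixProduct x m t

complementProduct : (ℕ → ℤ) → List ℕ → ℤ
complementProduct x []      = + 1
complementProduct x (a ∷ t) = (+ 1 - x a) * complementProduct x t

prefixProduct-∷ʳ : ∀ x m t a → m ≤ length t → prefixProduct x m (t ∷ʳ a) ≡ prefixProduct x m t
prefixProduct-∷ʳ x zero    t       a _         = refl
prefixProduct-∷ʳ x (suc m) (b ∷ t) a (s≤s m≤t) = cong (x b *_) (prefixProduct-∷ʳ x m t a m≤t)

product-∷ʳ : ∀ t a → product (t ∷ʳ a) ≡ a ℕ.* product t
product-∷ʳ t a = begin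
  product (t ++ a ∷ [])   ≡⟨ product-++ t (a ∷ []) ⟩
  product t ℕ.* (a ℕ.* 1) ≡⟨ cong (product t ℕ.*_) (ℕₚ.*-identityʳ a) ⟩
  product t ℕ.* a         ≡⟨ ℕₚ.*-comm (product t) a ⟩
  a ℕ.* product t         ∎
  where open ≡-Reasoning

module _ (k : ℕ) where

  length-tuplesUpTo : ∀ r → All (λ t → length t ≡ r) (tuplesUpTo r k)
  length-tuplesUpTo zero    = refl ∷ []
  length-tuplesUpTo (suc r) = Allₚ.concat⁺ (Allₚ.map⁺ (All.universal
    (λ a → Allₚ.map⁺ (All.map (cong suc) (length-tuplesUpTo r))) (upTo k)))

  ∑-tuplesUpTo-suc : ∀ r (g : List ℕ → ℤ) →
    ∑ (tuplesUpTo (suc r) k) g ≡ ∑[ a ∈ upTo k ] ∑[ t ∈ tuplesUpTo r k ] g (suc a ∷ t)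
  ∑-tuplesUpTo-suc r g =
    trans (∑-concatMap _ (upTo k) g) (∑-cong (upTo k) (λ a → ∑-map (suc a ∷_) (tuplesUpTo r k) g))

  -- The enumeration is invariant under rotating tuples, so the last entry can be split off like the first.
  ∑-tuplesUpTo-suc-∷ʳ : ∀ r (g : List ℕ → ℤ) →
    ∑ (tuplesUpTo (suc r) k) g ≡ ∑[ a ∈ upTo k ] ∑[ t ∈ tuplesUpTo r k ] g (t ∷ʳ suc a)
  ∑-tuplesUpTo-suc-∷ʳ zero    g = ∑-tuplesUpTo-suc zero g
  ∑-tuplesUpTo-suc-∷ʳ (suc r) g = begin
    ∑ (tuplesUpTo (suc (suc r)) k) g
      ≡⟨ ∑-tuplesUpTo-suc (suc r) g ⟩
    ∑[ b ∈ upTo k ] ∑[ u ∈ tuplesUpTo (suc r) k ] g (suc b ∷ u)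
      ≡⟨ ∑-cong (upTo k) (λ b → ∑-tuplesUpTo-suc-∷ʳ r (λ u → g (suc b ∷ u))) ⟩
    ∑[ b ∈ upTo k ] ∑[ a ∈ upTo k ] ∑[ t ∈ tuplesUpTo r k ] g (suc b ∷ t ∷ʳ suc a)
      ≡⟨ ∑-comm (upTo k) (upTo k) _ ⟩
    ∑[ a ∈ upTo k ] ∑[ b ∈ upTo k ] ∑[ t ∈ tuplesUpTo r k ] g (suc b ∷ t ∷ʳ suc a)
      ≡⟨ ∑-cong (upTo k) (λ a → ∑-tuplesUpTo-suc r (λ u → g (u ∷ʳ suc a))) ⟨
    ∑[ a ∈ upTo k ] ∑[ u ∈ tuplesUpTo (suc r) k ] g (u ∷ʳ suc a)
      ∎
    where open ≡-Reasoning

dilate : (ℕ → ℤ) → ℕ → ℕ → ℤ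
dilate f a n = f (a ℕ.* n)

-- For x the indicator of a set S, union r f weighs by f (product t) the tuples t with an entry
-- in S, and alternating r f is the inclusion–exclusion sum for them in which, by symmetry, only
-- the first m entries are required to lie in S.
module InclusionExclusion (x : ℕ → ℤ) (k : ℕ) where

  moment : ℕ → (ℕ → ℤ) → ℕ → ℤ
  moment r f m = ∑[ t ∈ tuplesUpTo r k ] f (product t) * prefixProduct x m t

  alternating : ℕ → (ℕ → ℤ) → ℤ
  alternating r f = sumFrom1 r (λ m → signPred m * + (r C m) * moment r f m)

  union : ℕ → (ℕ → ℤ) → ℤ
  union r f = ∑[ t ∈ tuplesUpTo r k ] f (product t) * (+ 1 - complementProduct x t)

  -- Both sides satisfy this recurrence in r, obtained by conditioning on one entry.
  recurrence : (ℕ → (ℕ → ℤ) → ℤ) → ℕ → (ℕ → ℤ) → ℤ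
  recurrence Φ r f = ∑[ a ∈ upTo k ]
    (Φ r (dilate f (suc a)) + x (suc a) * (moment r (dilate f (suc a)) 0 - Φ r (dilate f (suc a))))

  moment-suc-suc : ∀ r f m →
    moment (suc r) f (suc m) ≡ ∑[ a ∈ upTo k ] x (suc a) * moment r (dilate f (suc a)) m
  moment-suc-suc r f m = trans (∑-tuplesUpTo-suc k r _) (∑-cong (upTo k) λ a →
    trans (∑-cong (tuplesUpTo r k) (λ t → swap (f (suc a ℕ.* product t)) (x (suc a)) (prefixProduct x m t)))
          (∑-*ˡ (x (suc a)) (tuplesUpTo r k) _))
    where
    swap : ∀ u v w → u * (v * w) ≡ v * (u * w)
    swap = solve-∀

  moment-suc : ∀ r f {m} → m ≤ r →
    moment (suc r) f m ≡ ∑[ a ∈ upTo k ] moment r (dilate f (suc a)) m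
  moment-suc r f {m} m≤r = trans (∑-tuplesUpTo-suc-∷ʳ k r _) (∑-cong (upTo k) λ a →
    ∑-cong-All (All.map (λ {t} |t|≡r → cong₂ _*_ (cong f (product-∷ʳ t (suc a)))
                                         (prefixProduct-∷ʳ x m t (suc a) (subst (m ≤_) (sym |t|≡r) m≤r)))
                        (length-tuplesUpTo k r)))

  union-suc : ∀ r f → union (suc r) f ≡ recurrence union r f
  union-suc r f = trans (∑-tuplesUpTo-suc k r _) (∑-cong (upTo k) λ a → begin
    ∑[ t ∈ T ] g a t * (+ 1 - (+ 1 - x (suc a)) * complementProduct x t)
      ≡⟨ ∑-cong T (λ t → expand (g a t) (x (suc a)) (complementProduct x t)) ⟩
    ∑[ t ∈ T ] (g a t * (+ 1 - complementProduct x t) + x (suc a) * (g a t * + 1 - g a t * (+ 1 - complementProduct x t)))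
      ≡⟨ ∑-distrib-+ T _ _ ⟩
    union r (dilate f (suc a)) + (∑[ t ∈ T ] x (suc a) * (g a t * + 1 - g a t * (+ 1 - complementProduct x t)))
      ≡⟨ cong (_+_ (union r (dilate f (suc a)))) (trans (∑-*ˡ (x (suc a)) T _) (cong (x (suc a) *_) (∑-distrib-minus T _ _))) ⟩
    union r (dilate f (suc a)) + x (suc a) * (moment r (dilate f (suc a)) 0 - union r (dilate f (suc a)))
      ∎)
    where
    open ≡-Reasoning
    T = tuplesUpTo r k
    g : ℕ → List ℕ → ℤ
    g a t = f (suc a ℕ.* product t)
    expand : ∀ u v w → u * (+ 1 - (+ 1 - v) * w) ≡ u * (+ 1 - w) + v * (u * + 1 - u * (+ 1 - w))
    expand = solve-∀

  alternating-suc : ∀ r f → alternating (suc r) f ≡ recurrence alternating r f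
  alternating-suc r f = begin
    alternating (suc r) f
      ≡⟨ sumFrom1-cong (suc r) (λ {m} _ → reorder (signPred (suc m)) (+ (suc r C suc m)) (M (suc m))) ⟩
    sumFrom1 (suc r) (λ m → + (suc r C m) * (signPred m * M m))
      ≡⟨ sumFrom1-binomial r (λ m → signPred m * M m) ⟩
    sumFrom1 r (λ m → + (r C m) * (signPred m * M m))
      + (+ 1 * M 1 + sumFrom1 r (λ m → + (r C m) * (signPred (suc m) * M (suc m))))
      ≡⟨ cong₂ _+_ lower (cong₂ _+_ (trans (ℤₚ.*-identityˡ (M 1)) (moment-suc-suc r f 0)) shifted) ⟩
    (∑[ a ∈ U ] A a) + ((∑[ a ∈ U ] x (suc a) * N a 0) + (∑[ a ∈ U ] - x (suc a) * A a))
      ≡⟨ cong (_+_ (∑[ a ∈ U ] A a)) (∑-distrib-+ U _ _) ⟨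
    (∑[ a ∈ U ] A a) + (∑[ a ∈ U ] (x (suc a) * N a 0 + - x (suc a) * A a))
      ≡⟨ ∑-distrib-+ U _ _ ⟨
    ∑[ a ∈ U ] (A a + (x (suc a) * N a 0 + - x (suc a) * A a))
      ≡⟨ ∑-cong U (λ a → collect (A a) (x (suc a)) (N a 0)) ⟩
    recurrence alternating r f
      ∎
    where
    open ≡-Reasoning
    U = upTo k
    M : ℕ → ℤ
    M = moment (suc r) f
    N : ℕ → ℕ → ℤ
    N a = moment r (dilate f (suc a))
    A : ℕ → ℤ
    A a = alternating r (dilate f (suc a))
    reorder : ∀ s c u → s * c * u ≡ c * (s * u)
    reorder = solve-∀
    collect : ∀ u v w → u + (v * w + - v * u) ≡ u + v * (w - u)
    collect = solve-∀
    lower : sumFrom1 r (λ m → + (r C m) * (signPred m * M m)) ≡ ∑[ a ∈ U ] A a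
    lower = trans (sumFrom1-cong r λ {m} m<r → begin
        + (r C suc m) * (signPred (suc m) * M (suc m))
          ≡⟨ cong (λ z → + (r C suc m) * (signPred (suc m) * z)) (moment-suc r f m<r) ⟩
        + (r C suc m) * (signPred (suc m) * (∑[ a ∈ U ] N a (suc m)))
          ≡⟨ reorder (signPred (suc m)) (+ (r C suc m)) _ ⟨
        signPred (suc m) * + (r C suc m) * (∑[ a ∈ U ] N a (suc m))
          ≡⟨ ∑-*ˡ (signPred (suc m) * + (r C suc m)) U _ ⟨
        ∑[ a ∈ U ] signPred (suc m) * + (r C suc m) * N a (suc m)
          ∎)
      (sumFrom1-∑ r U _)
    shifted : sumFrom1 r (λ m → + (r C m) * (signPred (suc m) * M (suc m))) ≡ ∑[ a ∈ U ] - x (suc a) * A a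
    shifted = trans (sumFrom1-cong r λ {m} _ → begin
        + (r C suc m) * (- signPred (suc m) * M (suc (suc m)))
          ≡⟨ cong (λ z → + (r C suc m) * (- signPred (suc m) * z)) (moment-suc-suc r f (suc m)) ⟩
        + (r C suc m) * (- signPred (suc m) * (∑[ a ∈ U ] x (suc a) * N a (suc m)))
          ≡⟨ cong (+ (r C suc m) *_) (∑-*ˡ (- signPred (suc m)) U _) ⟨
        + (r C suc m) * (∑[ a ∈ U ] - signPred (suc m) * (x (suc a) * N a (suc m)))
          ≡⟨ ∑-*ˡ (+ (r C suc m)) U _ ⟨
        ∑[ a ∈ U ] + (r C suc m) * (- signPred (suc m) * (x (suc a) * N a (suc m)))
          ≡⟨ ∑-cong U (λ a → flip (+ (r C suc m)) (signPred (suc m)) (x (suc a)) (N a (suc m))) ⟩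
        ∑[ a ∈ U ] - x (suc a) * (signPred (suc m) * + (r C suc m) * N a (suc m))
          ∎)
      (trans (sumFrom1-∑ r U _) (∑-cong U (λ a → sumFrom1-*ˡ r (- x (suc a)) _)))
      where
      flip : ∀ c s v n → c * (- s * (v * n)) ≡ - v * (s * c * n)
      flip = solve-∀

  alternating≡union : ∀ r f → alternating r f ≡ union r f
  alternating≡union zero    f = vanish (f 1)
    where
    vanish : ∀ u → + 0 ≡ u * (+ 1 - + 1) + + 0
    vanish = solve-∀
  alternating≡union (suc r) f = begin
    alternating (suc r) f       ≡⟨ alternating-suc r f ⟩
    recurrence alternating r f  ≡⟨ ∑-cong (upTo k) (λ a → cong (λ Φ → Φ + x (suc a) * (moment r (dilate f (suc a)) 0 - Φ))
                                                            (alternating≡union r (dilate f (suc a)))) ⟩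
    recurrence union r f        ≡⟨ union-suc r f ⟨
    union (suc r) f             ∎
    where open ≡-Reasoning

𝟙-∣0 : ∀ p → 𝟙 (p ∣? 0) ≡ + 1
𝟙-∣0 p with p ∣? 0
... | yes _   = refl
... | no  p∤0 = contradiction (p ∣0) p∤0

𝟙-∣-gcd : ∀ p a b → 𝟙 (p ∣? gcd a b) ≡ 𝟙 (p ∣? a) * 𝟙 (p ∣? b)
𝟙-∣-gcd p a b with p ∣? gcd a b | p ∣? a | p ∣? b
... | yes _   | yes _   | yes _   = refl
... | yes p∣g | no  p∤a | _       = contradiction (∣-trans p∣g (gcd[m,n]∣m a b)) p∤a
... | yes p∣g | yes _   | no  p∤b = contradiction (∣-trans p∣g (gcd[m,n]∣n a b)) p∤b
... | no  p∤g | yes p∣a | yes p∣b = contradiction (gcd-greatest p∣a p∣b) p∤g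
... | no  _   | yes _   | no  _   = refl
... | no  _   | no  _   | _       = refl

𝟙-∣-gcdFirst : ∀ p m t → 𝟙 (p ∣? gcdFirst m t) ≡ prefixProduct (λ a → 𝟙 (p ∣? a)) m t
𝟙-∣-gcdFirst p zero    t       = 𝟙-∣0 p
𝟙-∣-gcdFirst p (suc m) []      = 𝟙-∣0 p
𝟙-∣-gcdFirst p (suc m) (a ∷ t) =
  trans (𝟙-∣-gcd p a (gcdFirst m t)) (cong (𝟙 (p ∣? a) *_) (𝟙-∣-gcdFirst p m t))

𝟙-∤-* : ∀ {p} → Prime p → ∀ a b →
        + 1 - 𝟙 (p ∣? a ℕ.* b) ≡ (+ 1 - 𝟙 (p ∣? a)) * (+ 1 - 𝟙 (p ∣? b))
𝟙-∤-* {p} pp a b with p ∣? a | p ∣? b | p ∣? a ℕ.* b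
... | yes _   | yes _   | yes _    = refl
... | yes _   | no  _   | yes _    = refl
... | no  _   | yes _   | yes _    = refl
... | no  _   | no  _   | no  _    = refl
... | yes p∣a | _       | no  p∤ab = contradiction (∣-trans p∣a (m∣m*n b)) p∤ab
... | no  _   | yes p∣b | no  p∤ab = contradiction (∣-trans p∣b (n∣m*n a)) p∤ab
... | no  p∤a | no  p∤b | yes p∣ab with euclidsLemma a b pp p∣ab
...   | inj₁ p∣a = contradiction p∣a p∤a
...   | inj₂ p∣b = contradiction p∣b p∤b

complementProduct-∣ : ∀ {p} → Prime p → ∀ t →
  complementProduct (λ a → 𝟙 (p ∣? a)) t ≡ + 1 - 𝟙 (p ∣? product t)
complementProduct-∣ {p} pp [] with p ∣? 1
... | yes p∣1 = contradiction (subst Prime (∣1⇒≡1 p∣1) pp) ¬prime[1]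
... | no  _   = refl
complementProduct-∣ {p} pp (a ∷ t) =
  trans (cong ((+ 1 - 𝟙 (p ∣? a)) *_) (complementProduct-∣ pp t)) (sym (𝟙-∤-* pp a (product t)))

alternating-∑-∣-gcdFirst : ∀ {p} → Prime p → ∀ r k →
  sumFrom1 r (λ m → signPred m * + (r C m) * (∑[ t ∈ factorizations r k ] 𝟙 (p ∣? gcdFirst m t)))
    ≡ 𝟙 (p ∣? k) * + τ r k
alternating-∑-∣-gcdFirst {p} pp r k = begin
  sumFrom1 r (λ m → signPred m * + (r C m) * (∑[ t ∈ F ] 𝟙 (p ∣? gcdFirst m t)))
    ≡⟨ sumFrom1-cong r (λ {m} _ → cong (signPred (suc m) * + (r C suc m) *_) (count≡moment (suc m))) ⟩
  alternating r isK
    ≡⟨ alternating≡union r isK ⟩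
  union r isK
    ≡⟨ ∑-cong T (λ t → 𝟙-*-cong (product t ≟ k) (λ t∈F → trans (𝟙-∣-product t) (cong (λ n → 𝟙 (p ∣? n)) t∈F))) ⟩
  ∑[ t ∈ T ] isK (product t) * 𝟙 (p ∣? k)
    ≡⟨ ∑-filter (λ t → product t ≟ k) T _ ⟨
  ∑[ t ∈ F ] 𝟙 (p ∣? k)
    ≡⟨ ∑-const (𝟙 (p ∣? k)) F ⟩
  𝟙 (p ∣? k) * + τ r k
    ∎
  where
  open ≡-Reasoning
  open InclusionExclusion (λ a → 𝟙 (p ∣? a)) k
  F = factorizations r k
  T = tuplesUpTo r k
  isK : ℕ → ℤ
  isK n = 𝟙 (n ≟ k)
  count≡moment : ∀ m → ∑[ t ∈ F ] 𝟙 (p ∣? gcdFirst m t) ≡ moment r isK m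
  count≡moment m = trans (∑-filter (λ t → product t ≟ k) T _)
    (∑-cong T (λ t → cong (isK (product t) *_) (𝟙-∣-gcdFirst p m t)))
  𝟙-∣-product : ∀ t → + 1 - complementProduct (λ a → 𝟙 (p ∣? a)) t ≡ 𝟙 (p ∣? product t)
  𝟙-∣-product t = trans (cong (_-_ (+ 1)) (complementProduct-∣ pp t)) (cancel (𝟙 (p ∣? product t)))
    where
    cancel : ∀ u → + 1 - (+ 1 - u) ≡ u
    cancel = solve-∀

primeDivisor? : (d : ℕ) → Decidable (λ p → Prime p × p ∣ d)
primeDivisor? d p = prime? p ×-dec p ∣? d

ω≡count-upTo : ∀ {d n} → d ≢ 0 → d ≤′ n → ω d ≡ length (filter (primeDivisor? d) (upTo (suc n)))
ω≡count-upTo d≢0 ≤′-refl                 = refl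
ω≡count-upTo {d} d≢0 (≤′-step {n} d≤′n) = begin
  ω d
    ≡⟨ ω≡count-upTo d≢0 d≤′n ⟩
  length (filter P? (upTo (suc n)))
    ≡⟨ cong length (Listₚ.++-identityʳ (filter P? (upTo (suc n)))) ⟨
  length (filter P? (upTo (suc n)) ++ [])
    ≡⟨ cong (λ ys → length (filter P? (upTo (suc n)) ++ ys)) (Listₚ.filter-reject P? too-large) ⟨
  length (filter P? (upTo (suc n)) ++ filter P? (suc n ∷ []))
    ≡⟨ cong length (Listₚ.filter-++ P? (upTo (suc n)) _) ⟨
  length (filter P? (upTo (suc n) ∷ʳ suc n))
    ≡⟨ cong (length ∘ filter P?) (Listₚ.upTo-∷ʳ (suc n)) ⟩
  length (filter P? (upTo (suc (suc n))))
    ∎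
  where
  open ≡-Reasoning
  P? = primeDivisor? d
  too-large : ¬ (Prime (suc n) × suc n ∣ d)
  too-large (_ , 1+n∣d) = ℕₚ.<⇒≱ (s≤s (ℕₚ.≤′⇒≤ d≤′n)) (∣⇒≤ {{ℕ.≢-nonZero d≢0}} 1+n∣d)

divisor≢0 : ∀ {d n} → d ∣ n → n ≢ 0 → d ≢ 0
divisor≢0 d∣n n≢0 refl = n≢0 (0∣⇒≡0 d∣n)

ω≡∑ : ∀ {d n} → d ∣ n → n ≢ 0 → + ω d ≡ ∑[ p ∈ upTo (suc n) ] 𝟙 (prime? p) * 𝟙 (p ∣? d)
ω≡∑ {d} {n} d∣n n≢0 = begin
  + ω d
    ≡⟨ cong +_ (ω≡count-upTo (divisor≢0 d∣n n≢0) (ℕₚ.≤⇒≤′ (∣⇒≤ {{ℕ.≢-nonZero n≢0}} d∣n))) ⟩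
  + length (filter (primeDivisor? d) (upTo (suc n)))
    ≡⟨ length-filter≡∑𝟙 (primeDivisor? d) (upTo (suc n)) ⟩
  ∑[ p ∈ upTo (suc n) ] 𝟙 (primeDivisor? d p)
    ≡⟨ ∑-cong (upTo (suc n)) (λ p → 𝟙-×-dec (prime? p) (p ∣? d)) ⟩
  ∑[ p ∈ upTo (suc n) ] 𝟙 (prime? p) * 𝟙 (p ∣? d)
    ∎
  where open ≡-Reasoning

ω-divisor : ∀ {d n} → d ∣ n → n ≢ 0 → (∀ {p} → Prime p → p ∣ n → p ∣ d) → ω d ≡ ω n
ω-divisor {d} {n} d∣n n≢0 radical = begin
  ω d
    ≡⟨ ω≡count-upTo (divisor≢0 d∣n n≢0) (ℕₚ.≤⇒≤′ (∣⇒≤ {{ℕ.≢-nonZero n≢0}} d∣n)) ⟩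
  length (filter (primeDivisor? d) (upTo (suc n)))
    ≡⟨ cong length (Listₚ.filter-≐ (primeDivisor? d) (primeDivisor? n) (to , from) (upTo (suc n))) ⟩
  ω n
    ∎
  where
  open ≡-Reasoning
  to : ∀ {p} → Prime p × p ∣ d → Prime p × p ∣ n
  to (pp , p∣d) = pp , ∣-trans p∣d d∣n
  from : ∀ {p} → Prime p × p ∣ n → Prime p × p ∣ d
  from (pp , p∣n) = pp , radical pp p∣n

lcmList∣product : ∀ t → lcmList t ∣ product t
lcmList∣product []      = ∣-refl
lcmList∣product (a ∷ t) = lcm-least (m∣m*n {a} (product t)) (∣-trans (lcmList∣product t) (n∣m*n a))

prime∣product⇒∣lcmList : ∀ {p} → Prime p → ∀ t → p ∣ product t → p ∣ lcmList t
prime∣product⇒∣lcmList pp []      p∣1 = contradiction (subst Prime (∣1⇒≡1 p∣1) pp) ¬prime[1]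
prime∣product⇒∣lcmList pp (a ∷ t) p∣at with euclidsLemma a (product t) pp p∣at
... | inj₁ p∣a = ∣-trans p∣a (m∣lcm[m,n] a (lcmList t))
... | inj₂ p∣t = ∣-trans (prime∣product⇒∣lcmList pp t p∣t) (n∣lcm[m,n] a (lcmList t))

ω-lcmList : ∀ {k} t → k ≢ 0 → product t ≡ k → ω (lcmList t) ≡ ω k
ω-lcmList t k≢0 refl = ω-divisor (lcmList∣product t) k≢0 (λ pp → prime∣product⇒∣lcmList pp t)

gcdFirst-suc∣product : ∀ m t → product t ≢ 1 → gcdFirst (suc m) t ∣ product t
gcdFirst-suc∣product m []      1≢1 = contradiction refl 1≢1
gcdFirst-suc∣product m (a ∷ t) _   = ∣-trans (gcd[m,n]∣m a (gcdFirst m t)) (m∣m*n (product t))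

sum-map-const : ∀ {A : Set} (h : A → ℕ) {c xs} → All (λ x → h x ≡ c) xs → sum (map h xs) ≡ c ℕ.* length xs
sum-map-const h {c} []                = sym (ℕₚ.*-zeroʳ c)
sum-map-const h {c} {_ ∷ xs} (e ∷ es) = trans (cong₂ ℕ._+_ e (sum-map-const h es)) (sym (ℕₚ.*-suc c (length xs)))

product≡k : ∀ r k → All (λ t → product t ≡ k) (factorizations r k)
product≡k r k = Allₚ.all-filter (λ t → product t ≟ k) (tuplesUpTo r k)

∑-ω-lcmList : ∀ r k → k ≢ 0 → sum (map (λ t → ω (lcmList t)) (factorizations r k)) ≡ ω k ℕ.* τ r k
∑-ω-lcmList r k k≢0 = sum-map-const _ (All.map (λ {t} → ω-lcmList t k≢0) (product≡k r k))

∑-ω-gcdFirst : ∀ r k m → 2 ≤ k →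
  + sum (map (λ t → ω (gcdFirst (suc m) t)) (factorizations r k))
    ≡ ∑[ p ∈ upTo (suc k) ] 𝟙 (prime? p) * (∑[ t ∈ factorizations r k ] 𝟙 (p ∣? gcdFirst (suc m) t))
∑-ω-gcdFirst r k m 2≤k = begin
  + sum (map (λ t → ω (gcdFirst (suc m) t)) F)
    ≡⟨ sum-map≡∑ _ F ⟩
  ∑[ t ∈ F ] + ω (gcdFirst (suc m) t)
    ≡⟨ ∑-cong-All (All.map (λ {t} t∈F → ω≡∑ (gcd∣k t t∈F) (ℕₚ.m<n⇒n≢0 2≤k)) (product≡k r k)) ⟩
  ∑[ t ∈ F ] ∑[ p ∈ P ] 𝟙 (prime? p) * 𝟙 (p ∣? gcdFirst (suc m) t)
    ≡⟨ ∑-comm F P _ ⟩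
  ∑[ p ∈ P ] ∑[ t ∈ F ] 𝟙 (prime? p) * 𝟙 (p ∣? gcdFirst (suc m) t)
    ≡⟨ ∑-cong P (λ p → ∑-*ˡ (𝟙 (prime? p)) F _) ⟩
  ∑[ p ∈ P ] 𝟙 (prime? p) * (∑[ t ∈ F ] 𝟙 (p ∣? gcdFirst (suc m) t))
    ∎
  where
  open ≡-Reasoning
  F = factorizations r k
  P = upTo (suc k)
  gcd∣k : ∀ t → product t ≡ k → gcdFirst (suc m) t ∣ k
  gcd∣k t refl = gcdFirst-suc∣product m t (ℕₚ.>⇒≢ 2≤k)

alternating-∑-ω-gcdFirst : ∀ r k → 2 ≤ k →
  sumFrom1 r (λ m → signPred m * + (r C m) * + sum (map (λ t → ω (gcdFirst m t)) (factorizations r k)))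
    ≡ + (ω k ℕ.* τ r k)
alternating-∑-ω-gcdFirst r k 2≤k = begin
  sumFrom1 r (λ m → signPred m * + (r C m) * + sum (map (λ t → ω (gcdFirst m t)) (factorizations r k)))
    ≡⟨ sumFrom1-cong r (λ {m} _ → trans (cong (c (suc m) *_) (∑-ω-gcdFirst r k m 2≤k))
                                        (sym (∑-*ˡ (c (suc m)) P (λ p → 𝟙 (prime? p) * count p (suc m))))) ⟩
  sumFrom1 r (λ m → ∑[ p ∈ P ] c m * (𝟙 (prime? p) * count p m))
    ≡⟨ sumFrom1-∑ r P _ ⟩
  ∑[ p ∈ P ] sumFrom1 r (λ m → c m * (𝟙 (prime? p) * count p m))
    ≡⟨ ∑-cong P (λ p → trans (sumFrom1-cong r (λ {m} _ → swap (c (suc m)) (𝟙 (prime? p)) (count p (suc m))))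
                             (sumFrom1-*ˡ r (𝟙 (prime? p)) _)) ⟩
  ∑[ p ∈ P ] 𝟙 (prime? p) * sumFrom1 r (λ m → c m * count p m)
    ≡⟨ ∑-cong P (λ p → 𝟙-*-cong (prime? p) (λ pp → alternating-∑-∣-gcdFirst pp r k)) ⟩
  ∑[ p ∈ P ] 𝟙 (prime? p) * (𝟙 (p ∣? k) * + τ r k)
    ≡⟨ ∑-cong P (λ p → rotate (𝟙 (prime? p)) (𝟙 (p ∣? k)) (+ τ r k)) ⟩
  ∑[ p ∈ P ] + τ r k * (𝟙 (prime? p) * 𝟙 (p ∣? k))
    ≡⟨ ∑-*ˡ (+ τ r k) P _ ⟩
  + τ r k * (∑[ p ∈ P ] 𝟙 (prime? p) * 𝟙 (p ∣? k))
    ≡⟨ cong (+ τ r k *_) (ω≡∑ ∣-refl (ℕₚ.m<n⇒n≢0 2≤k)) ⟨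
  + τ r k * + ω k
    ≡⟨ trans (ℤₚ.*-comm (+ τ r k) (+ ω k)) (sym (ℤₚ.pos-* (ω k) (τ r k))) ⟩
  + (ω k ℕ.* τ r k)
    ∎
  where
  open ≡-Reasoning
  P = upTo (suc k)
  c : ℕ → ℤ
  c m = signPred m * + (r C m)
  count : ℕ → ℕ → ℤ
  count p m = ∑[ t ∈ factorizations r k ] 𝟙 (p ∣? gcdFirst m t)
  swap : ∀ a b c → a * (b * c) ≡ b * (a * c)
  swap = solve-∀
  rotate : ∀ a b c → a * (b * c) ≡ c * (a * b)
  rotate = solve-∀

lemma1 : (k r : ℕ) → 2 ≤ k → 2 ≤ r →
    (sum (map (λ t → ω (lcmList t)) (factorizations r k)) ≡ ω k ℕ.* τ r k)
    × (sumFrom1 r (λ m → signPred m ℤ.* (ℤ.+ (r C m)) ℤ.* (ℤ.+ sum (map (λ t → ω (gcdFirst m t)) (factorizations r k))))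
    ≡ ℤ.+ (ω k ℕ.* τ r k))
lemma1 k r 2≤k _ = ∑-ω-lcmList r k (ℕₚ.m<n⇒n≢0 2≤k) , alternating-∑-ω-gcdFirst r k 2≤k
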